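{- Let $1\le q_1<q_2<\cdots$ be a strictly increasing sequence of integers with partial sums $S_n=q_1+\cdots+q_n$. For $n\in\mathbb{N}$ consider the polynomial $$f_n(x)=(1+x^{q_1})(1+x^{q_2})\cdots(1+x^{q_n})=\sum_{m=0}^{S_n}\gamma_m(n)\,x^m .$$ Suppose there exist positive integers $k_0$ and $n_0$ such that $$2k_0+q_{n+1}\le S_n\quad\text{for all } n\ge n_0,\qquad\text{and}\qquad \gamma_m(n_0)\ge 1\quad\text{for all integers } m \text{ with } k_0\le m\le S_{n_0}-k_0 .$$ Then every integer $N\ge k_0$ is a sum of one or more pairwise distinct members of $\{q_1,q_2,\dots\}$.
   Context: $\gamma_m(n)$ denotes the coefficient of $x^m$ in $f_n(x)$. -}

module Defs where

open import Data.Nat using (ℕ; zero; suc; _+_; _*_)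
open import Data.List using (List; []; _∷_; map; sum; replicate)

-- Polynomials with natural-number coefficients, as coefficient lists
-- (head = coefficient of x^0).
Poly : Set
Poly = List ℕ

_⊕_ : Poly → Poly → Poly
[] ⊕ g = g
(a ∷ f) ⊕ [] = a ∷ f
(a ∷ f) ⊕ (b ∷ g) = (a + b) ∷ (f ⊕ g)

scale : ℕ → Poly → Poly
scale c = map (c *_)

_⊗_ : Poly → Poly → Poly
[] ⊗ g = []
(a ∷ f) ⊗ g = scale a g ⊕ (0 ∷ (f ⊗ g))

onePlusXPow : ℕ → Poly
onePlusXPow zero = 2 ∷ []
onePlusXPow (suc k) = 1 ∷ (replicate k 0 Data.List.++ (1 ∷ []))

coeff : Poly → ℕ → ℕ
coeff [] m = 0
coeff (a ∷ f) zero = a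
coeff (a ∷ f) (suc m) = coeff f m

-- The sequence q₁, q₂, … is represented by q : ℕ → ℕ with q i = q_{i+1}.
-- Partial sum S_n = q₁ + ⋯ + q_n
S : (ℕ → ℕ) → ℕ → ℕ
S q zero = 0
S q (suc n) = S q n + q n

f : (ℕ → ℕ) → ℕ → Poly
f q zero = 1 ∷ []
f q (suc n) = f q n ⊗ onePlusXPow (q n)

γ : (ℕ → ℕ) → ℕ → ℕ → ℕ
γ q m n = coeff (f q n) m

-- A coefficient γ_m(n) ≥ 1 means that m is a sum of distinct q_i with i < n. Call
-- the interval k₀ ≤ m ≤ S_n − k₀ good at stage n if all its members are such sums;
-- it is good at n₀ by hypothesis. Passing from n to n + 1 the interval grows by q_n
-- at the top: a new m with S_n − k₀ < m ≤ S_{n+1} − k₀ is written m = q_n + m', and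
-- 2k₀ + q_n ≤ S_n forces k₀ ≤ m' ≤ S_n − k₀, so m' is already a sum of distinct
-- q_i with i < n. Since S_n ≥ n, every N ≥ k₀ eventually lies in a good interval.
module Submission where

open import Defs
open import Data.Nat using (ℕ; zero; suc; _+_; _*_; _∸_; _≤_; _<_; z≤n; s≤s; _≤?_)
open import Data.Nat.Properties
open import Data.Nat.ListAction using (sum)
open import Data.Nat.Solver using (module +-*-Solver)
open import Data.List using (List; []; _∷_; _++_; map; replicate)
open import Data.List.Relation.Unary.All as All using (All; []; _∷_)
open import Data.List.Relation.Unary.AllPairs using ([]; _∷_)
open import Data.List.Relation.Unary.Unique.Propositional using (Unique)
open import Data.Product using (Σ; _×_; ∃; _,_)
open import Data.Sum using (_⊎_; inj₁; inj₂)
open import Relation.Binary.PropositionalEquality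
  using (_≡_; _≢_; refl; sym; trans; cong; subst; subst₂)
open import Relation.Nullary using (yes; no)

+-positive : ∀ x y → 1 ≤ x + y → 1 ≤ x ⊎ 1 ≤ y
+-positive zero    y 1≤y = inj₂ 1≤y
+-positive (suc x) y _   = inj₁ (s≤s z≤n)

*-positive : ∀ x y → 1 ≤ x * y → 1 ≤ x × 1 ≤ y
*-positive (suc x) (suc y) _ = s≤s z≤n , s≤s z≤n
*-positive (suc x) zero 1≤x*0 with subst (1 ≤_) (*-zeroʳ x) 1≤x*0
... | ()

coeff-⊕ : ∀ p g m → coeff (p ⊕ g) m ≡ coeff p m + coeff g m
coeff-⊕ []      g       m       = refl
coeff-⊕ (a ∷ p) []      m       = sym (+-identityʳ _)
coeff-⊕ (a ∷ p) (b ∷ g) zero    = refl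
coeff-⊕ (a ∷ p) (b ∷ g) (suc m) = coeff-⊕ p g m

coeff-scale : ∀ c p m → coeff (scale c p) m ≡ c * coeff p m
coeff-scale c []      m       = sym (*-zeroʳ c)
coeff-scale c (a ∷ p) zero    = refl
coeff-scale c (a ∷ p) (suc m) = coeff-scale c p m

coeff-⊗-positive : ∀ p g m → 1 ≤ coeff (p ⊗ g) m →
  ∃ λ i → ∃ λ j → i + j ≡ m × 1 ≤ coeff p i × 1 ≤ coeff g j
coeff-⊗-positive (a ∷ p) g m pos
  with +-positive (a * coeff g m) (coeff (0 ∷ (p ⊗ g)) m) (subst (1 ≤_) split pos)
  where
    split : coeff ((a ∷ p) ⊗ g) m ≡ a * coeff g m + coeff (0 ∷ (p ⊗ g)) m
    split = trans (coeff-⊕ (scale a g) (0 ∷ (p ⊗ g)) m)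
                  (cong (_+ coeff (0 ∷ (p ⊗ g)) m) (coeff-scale a g m))
... | inj₁ head-pos = let (a-pos , g-pos) = *-positive a (coeff g m) head-pos
                      in 0 , m , refl , a-pos , g-pos
coeff-⊗-positive (a ∷ p) g (suc m) _ | inj₂ tail-pos
  with coeff-⊗-positive p g m tail-pos
... | i , j , i+j≡m , p-pos , g-pos = suc i , j , cong suc i+j≡m , p-pos , g-pos

coeff-monomial-positive : ∀ k j → 1 ≤ coeff (replicate k 0 ++ (1 ∷ [])) j → j ≡ k
coeff-monomial-positive zero    zero    _   = refl
coeff-monomial-positive (suc k) (suc j) pos = cong suc (coeff-monomial-positive k j pos)

coeff-onePlusXPow-positive : ∀ k j → 1 ≤ coeff (onePlusXPow k) j → j ≡ 0 ⊎ j ≡ k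
coeff-onePlusXPow-positive zero    zero    _   = inj₁ refl
coeff-onePlusXPow-positive (suc k) zero    _   = inj₁ refl
coeff-onePlusXPow-positive (suc k) (suc j) pos =
  inj₂ (cong suc (coeff-monomial-positive k j pos))

+-shift-≤ : ∀ k a s m → 2 * k + a ≤ s → s < m + k → a + k ≤ m
+-shift-≤ k a s m 2k+a≤s s<m+k =
  <⇒≤ (+-cancelʳ-< k (a + k) m (≤-<-trans (subst (_≤ s) (reassoc k a) 2k+a≤s) s<m+k))
  where
    open +-*-Solver
    reassoc : ∀ k a → 2 * k + a ≡ (a + k) + k
    reassoc = solve 2 (λ k a → con 2 :* k :+ a := (a :+ k) :+ k) refl

module _ (q : ℕ → ℕ) where

  DistinctSum : ℕ → ℕ → Set
  DistinctSum n m = Σ (List ℕ) λ I → All (_< n) I × Unique I × sum (map q I) ≡ m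

  DistinctSum-weaken : ∀ {n m} → DistinctSum n m → DistinctSum (suc n) m
  DistinctSum-weaken (I , I<n , uniq , sum≡m) = I , All.map m<n⇒m<1+n I<n , uniq , sum≡m

  DistinctSum-extend : ∀ {n m} → DistinctSum n m → DistinctSum (suc n) (q n + m)
  DistinctSum-extend {n} (I , I<n , uniq , sum≡m) =
    n ∷ I ,
    n<1+n n ∷ All.map m<n⇒m<1+n I<n ,
    All.map (λ i<n i≡n → <⇒≢ i<n (sym i≡n)) I<n ∷ uniq ,
    cong (q n +_) sum≡m

  γ-positive⇒DistinctSum : ∀ n m → 1 ≤ γ q m n → DistinctSum n m
  γ-positive⇒DistinctSum zero zero _ = [] , [] , [] , refl
  γ-positive⇒DistinctSum (suc n) m pos
    with coeff-⊗-positive (f q n) (onePlusXPow (q n)) m pos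
  ... | i , j , i+j≡m , fi-pos , j-pos
    with γ-positive⇒DistinctSum n i fi-pos | coeff-onePlusXPow-positive (q n) j j-pos
  ... | rep | inj₁ refl =
        subst (DistinctSum (suc n)) (trans (sym (+-identityʳ i)) i+j≡m) (DistinctSum-weaken rep)
  ... | rep | inj₂ refl =
        subst (DistinctSum (suc n)) (trans (+-comm (q n) i) i+j≡m) (DistinctSum-extend rep)

  -- The interval k ≤ m ≤ S q n ∸ k, written without truncated subtraction.
  IntervalRepresented : ℕ → ℕ → Set
  IntervalRepresented k n = ∀ m → k ≤ m → m + k ≤ S q n → DistinctSum n m

  IntervalRepresented-suc : ∀ {k n} → 2 * k + q n ≤ S q n →
    IntervalRepresented k n → IntervalRepresented k (suc n)
  IntervalRepresented-suc {k} {n} 2k+q≤S good m k≤m m+k≤S′ with m + k ≤? S q n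
  ... | yes m+k≤S = DistinctSum-weaken (good m k≤m m+k≤S)
  ... | no  m+k≰S with +-shift-≤ k (q n) (S q n) m 2k+q≤S (≰⇒> m+k≰S)
  ...   | q+k≤m with m≤n⇒∃[o]m+o≡n (m+n≤o⇒m≤o (q n) q+k≤m)
  ...     | m′ , refl = DistinctSum-extend (good m′ k≤m′ m′+k≤S)
    where
      k≤m′ : k ≤ m′
      k≤m′ = +-cancelˡ-≤ (q n) k m′ q+k≤m
      m′+k≤S : m′ + k ≤ S q n
      m′+k≤S = +-cancelˡ-≤ (q n) (m′ + k) (S q n)
        (subst₂ _≤_ (+-assoc (q n) m′ k) (+-comm (S q n) (q n)) m+k≤S′)

  IntervalRepresented-from : ∀ k n₀ → (∀ n → n₀ ≤ n → 2 * k + q n ≤ S q n) →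
    IntervalRepresented k n₀ → ∀ t → IntervalRepresented k (t + n₀)
  IntervalRepresented-from k n₀ growth good zero    = good
  IntervalRepresented-from k n₀ growth good (suc t) =
    IntervalRepresented-suc (growth (t + n₀) (m≤n+m n₀ t))
      (IntervalRepresented-from k n₀ growth good t)

  increasing⇒positive : 1 ≤ q 0 → (∀ i → q i < q (1 + i)) → ∀ i → 1 ≤ q i
  increasing⇒positive 1≤q₀ increasing zero    = 1≤q₀
  increasing⇒positive 1≤q₀ increasing (suc i) =
    ≤-trans (increasing⇒positive 1≤q₀ increasing i) (<⇒≤ (increasing i))

  n≤S : (∀ i → 1 ≤ q i) → ∀ n → n ≤ S q n
  n≤S pos zero    = z≤n
  n≤S pos (suc n) = subst (_≤ S q n + q n) (+-comm n 1) (+-mono-≤ (n≤S pos n) (pos n))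

theorem2p1 : (q : ℕ → ℕ)
    → (1 ≤ q 0)
    → (∀ i → q i < q (1 + i))
    → (k₀ n₀ : ℕ) → 1 ≤ k₀ → 1 ≤ n₀
    → (∀ n → n₀ ≤ n → 2 * k₀ + q n ≤ S q n)
    → (∀ m → k₀ ≤ m → m ≤ S q n₀ ∸ k₀ → 1 ≤ γ q m n₀)
    → ∀ N → k₀ ≤ N
    → Σ (List ℕ) λ I → (I ≢ []) × Unique I × (sum (map q I) ≡ N)
theorem2p1 q 1≤q₀ increasing k₀ n₀ 1≤k₀ _ growth γ-pos N k₀≤N
  with IntervalRepresented-from q k₀ n₀ growth base (N + k₀) N k₀≤N
         (≤-trans (m≤m+n (N + k₀) n₀) (n≤S q positive (N + k₀ + n₀)))
  where
    positive : ∀ i → 1 ≤ q i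
    positive = increasing⇒positive q 1≤q₀ increasing
    base : IntervalRepresented q k₀ n₀
    base m k₀≤m m+k₀≤S =
      γ-positive⇒DistinctSum q n₀ m (γ-pos m k₀≤m (m+n≤o⇒m≤o∸n m m+k₀≤S))
... | I , _ , uniq , sum≡N = I , nonempty , uniq , sum≡N
  where
    nonempty : I ≢ []
    nonempty refl with ≤-trans 1≤k₀ (≤-trans k₀≤N (≤-reflexive (sym sum≡N)))
    ... | ()
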